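{- Let $H$ be a comparability graph, let $B$ be the canonical modular decomposition of $H$, and let $(T,D)$ be a restricted modular decomposition of $H$. Let $uv$ and $wx$ be edges of $H$ such that $\mu=\mathrm{lca}_B(u,v)$ and $\nu=\mathrm{lca}_B(w,x)$ are complete nodes of $B$, and such that $uv$ and $wx$ are represented in $T$ by the same edge of the quotient graph of a node of $T$ labeled complete. Then $\mu=\nu$.
   Context: For a rooted tree $T$ and node $\mu$, $L(\mu)$ is the leaf set of the subtree rooted at $\mu$; $\mathrm{lca}_T$ is the lowest common ancestor in $T$. A module of $H=(V,E)$ is a nonempty $M\subseteq V$ such that each vertex outside $M$ is adjacent to all or none of $M$; a graph with $\ge3$ vertices is prime if its only modules are $V$ and singletons. A modular decomposition of $H$ is a rooted tree with leaf set $V$ such that every $L(\mu)$ is a module; the quotient graph $H[\mu]$ of an inner node $\mu$ is obtained from $H[L(\mu)]$ by contracting $L(\lambda)$ into one vertex for each child $\lambda$ (vertices identified with children). An edge $uv$ of $H$ is represented in a modular decomposition $T$ by the edge $\lambda_1\lambda_2$ of $H[\omega]$, where $\omega=\mathrm{lca}_T(u,v)$ and $\lambda_1,\lambda_2$ are the children of $\omega$ with $u\in L(\lambda_1)$, $v\in L(\lambda_2)$. The canonical modular decomposition is the unique modular decomposition whose quotient graphs are all edgeless (empty), complete or prime, with no two adjacent nodes both complete or both empty; a node is complete if its quotient graph is complete. A restricted modular decomposition $(T,D)$ of a comparability graph $H$ is a modular decomposition $T$ of $H$ in which each inner node is labeled complete, empty or prime, such that every node labeled complete (resp. empty) has a complete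 (resp. edgeless) quotient graph, together with a function $D$ assigning to each node labeled prime a transitive orientation of its quotient graph. -}

module Defs where

open import Level using (Lift)
open import Data.Nat using (ℕ; _≤_)
open import Data.Fin using (Fin)
open import Data.Fin.Subset using (Subset; _∈_; _∉_; ⊤; ⁅_⁆)
open import Data.Product using (Σ; ∃; ∃-syntax; _×_; _,_)
open import Data.Sum using (_⊎_)
open import Data.Unit using () renaming (⊤ to Unit)
open import Data.Empty using (⊥)
open import Relation.Nullary using (¬_)
open import Relation.Binary.PropositionalEquality using (_≡_; _≢_)

record Graph (n : ℕ) : Set₁ where
  field
    E     : Fin n → Fin n → Set
    sym   : ∀ {a b} → E a b → E b a
    irrefl : ∀ {a} → ¬ E a a
open Graph public

record IsTransitiveOrientation {A : Set} (R : A → A → Set) (O : A → A → Set) : Set where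
  field
    sub-edges : ∀ {a b} → O a b → R a b
    total     : ∀ {a b} → R a b → O a b ⊎ O b a
    antisym   : ∀ {a b} → O a b → ¬ O b a
    trans     : ∀ {a b c} → O a b → O b c → O a c

TransitiveOrientation : {A : Set} → (A → A → Set) → Set₁
TransitiveOrientation {A} R = Σ (A → A → Set) (IsTransitiveOrientation R)

IsComparability : ∀ {n} → Graph n → Set₁
IsComparability G = TransitiveOrientation (E G)

IsModule : {A : Set} → (A → A → Set) → (A → Set) → Set
IsModule {A} R M =
  (∃ λ x → M x) ×
  (∀ z → ¬ M z → (∀ y → M y → R z y) ⊎ (∀ y → M y → ¬ R z y))

IsPrimeGraph : ∀ {k} → (Fin k → Fin k → Set) → Set
IsPrimeGraph {k} R =
  3 ≤ k ×
  (∀ (M : Subset k) → IsModule R (_∈ M) → M ≡ ⊤ ⊎ ∃ λ x → M ≡ ⁅ x ⁆)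

data Tree (n : ℕ) : Set where
  leaf : Fin n → Tree n
  node : (k : ℕ) → (Fin k → Tree n) → Tree n

-- Nodes of a tree, given by their position (path from the root).
data Pos {n : ℕ} : Tree n → Set where
  here  : ∀ {t} → Pos t
  there : ∀ {k f} (i : Fin k) → Pos (f i) → Pos (node k f)

sub : ∀ {n} {t : Tree n} → Pos t → Tree n
sub {t = t} here = t
sub (there i p) = sub p

data _∈L_ {n : ℕ} (v : Fin n) : Tree n → Set where
  here  : v ∈L leaf v
  there : ∀ {k f} (i : Fin k) → v ∈L f i → v ∈L node k f

L : ∀ {n} {t : Tree n} → Pos t → Fin n → Set
L p v = v ∈L sub p

data ChildOf {n : ℕ} : {t : Tree n} → Pos t → Pos t → Set where
  c-here  : ∀ {k} {f : Fin k → Tree n} (i : Fin k) →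
            ChildOf {t = node k f} (there {f = f} i (here {t = f i})) here
  c-there : ∀ {k} {f : Fin k → Tree n} (i : Fin k) {p q : Pos (f i)} →
            ChildOf q p → ChildOf {t = node k f} (there {f = f} i q) (there i p)

IsLCA : ∀ {n} {t : Tree n} → Pos t → Fin n → Fin n → Set
IsLCA {t = t} ω u v =
  L ω u × L ω v × (∀ (λ' : Pos t) → ChildOf λ' ω → ¬ (L λ' u × L λ' v))

HasLeafSet : ∀ {n} → Tree n → Set
HasLeafSet t = ∀ v → (v ∈L t) × (∀ (p q : v ∈L t) → p ≡ q)

QE : ∀ {n} (G : Graph n) {k} → (Fin k → Tree n) → Fin k → Fin k → Set
QE G f i j = i ≢ j × ∃[ a ] ∃[ b ] (a ∈L f i × b ∈L f j × E G a b)

IsInner : ∀ {n} → Tree n → Set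
IsInner (leaf _)   = ⊥
IsInner (node _ _) = Unit

IsCompleteNode : ∀ {n} → Graph n → Tree n → Set
IsCompleteNode G (leaf _)   = ⊥
IsCompleteNode G (node k f) = ∀ i j → i ≢ j → QE G f i j

IsEmptyNode : ∀ {n} → Graph n → Tree n → Set
IsEmptyNode G (leaf _)   = ⊥
IsEmptyNode G (node k f) = ∀ i j → ¬ QE G f i j

IsPrimeNode : ∀ {n} → Graph n → Tree n → Set
IsPrimeNode G (leaf _)   = ⊥
IsPrimeNode G (node k f) = IsPrimeGraph (QE G f)

AtLeastTwoChildren : ∀ {n} → Tree n → Set
AtLeastTwoChildren (leaf _)   = Unit
AtLeastTwoChildren (node k f) = 2 ≤ k

QuotientOrientation : ∀ {n} → Graph n → Tree n → Set₁
QuotientOrientation G (leaf _)   = Lift _ Unit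
QuotientOrientation G (node k f) = TransitiveOrientation (QE G f)

record IsModularDecomposition {n} (G : Graph n) (T : Tree n) : Set where
  field
    leafSet : HasLeafSet T
    modules : ∀ (μ : Pos T) → IsModule (E G) (L μ)

record IsCanonicalMD {n} (G : Graph n) (B : Tree n) : Set where
  field
    isMD      : IsModularDecomposition G B
    -- (standard convention implicit in uniqueness: no unary inner nodes)
    branching : ∀ (μ : Pos B) → AtLeastTwoChildren (sub μ)
    types     : ∀ (μ : Pos B) → IsInner (sub μ) →
                IsEmptyNode G (sub μ) ⊎ IsCompleteNode G (sub μ) ⊎ IsPrimeNode G (sub μ)
    noCC      : ∀ (μ λ' : Pos B) → ChildOf λ' μ →
                ¬ (IsCompleteNode G (sub μ) × IsCompleteNode G (sub λ'))
    noEE      : ∀ (μ λ' : Pos B) → ChildOf λ' μ →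
                ¬ (IsEmptyNode G (sub μ) × IsEmptyNode G (sub λ'))

data Label : Set where
  complete empty prime : Label

record RestrictedMD {n} (G : Graph n) (T : Tree n) : Set₁ where
  field
    isMD       : IsModularDecomposition G T
    label      : Pos T → Label   -- only meaningful on inner nodes
    labelComplete : ∀ (μ : Pos T) → IsInner (sub μ) → label μ ≡ complete →
                    IsCompleteNode G (sub μ)
    labelEmpty : ∀ (μ : Pos T) → IsInner (sub μ) → label μ ≡ empty →
                 IsEmptyNode G (sub μ)
    D          : ∀ (μ : Pos T) → IsInner (sub μ) → label μ ≡ prime →
                 QuotientOrientation G (sub μ)
open RestrictedMD public

-- Let A and C be the leaf sets of the two children of the complete node of T
-- representing both edges: A and C are modules and every vertex of A is adjacent
-- to every vertex of C. The heart of the proof is that a complete node μ of the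
-- canonical decomposition B whose leaves meet both A and C contains all of A ∪ C.
-- Otherwise some y ∈ A leaves μ; look at the node ρ where the paths to μ and y
-- split. If ρ is empty, y is adjacent to a vertex of C below μ, contradiction. If ρ
-- is prime, the module A meets two children of ρ, hence covers ρ, and swallows
-- a vertex of C. If ρ is complete, the child σ of ρ above μ is not (canonicity), and
-- y is adjacent to all of σ; then the child of σ containing μ is adjacent in the
-- quotient of σ to every other child (through a vertex of C if the other child
-- meets A, through a vertex of A otherwise), which neither an empty nor a prime
-- quotient allows. Hence both lca's contain u, v, w, x and are equal.
{-# OPTIONS --safe #-}
module Submission where

open import Defs
open import Data.Nat using (ℕ; _≤_; s≤s)
open import Data.Fin using (Fin; zero; suc; _≟_)
open import Data.Fin.Properties using (any?)
open import Data.Fin.Subset using (Subset; _∈_; ⁅_⁆; ∁)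
open import Data.Fin.Subset.Properties
  using (∈⊤; x∈⁅x⁆; x∈⁅y⁆⇒x≡y; x≢y⇒x∉⁅y⁆; x∉⁅y⁆⇒x≢y; x∈∁p⇒x∉p; x∉p⇒x∈∁p; x∉∁p⇒x∈p)
open import Data.Vec using (tabulate)
open import Data.Vec.Properties using (lookup∘tabulate; []=⇒lookup; lookup⇒[]=)
open import Data.Unit using (tt)
open import Data.Product using (∃; ∃₂; _×_; _,_; proj₁; proj₂)
open import Data.Sum as Sum using (_⊎_; inj₁; inj₂)
open import Data.Empty using (⊥; ⊥-elim)
open import Function using (_∘_)
open import Relation.Nullary using (¬_; Dec; yes; no; does; proof)
open import Relation.Nullary.Reflects using (Reflects; invert)
open import Relation.Nullary.Decidable using (_×-dec_; dec-true)
open import Relation.Unary using (Decidable)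
open import Relation.Binary.PropositionalEquality
  using (_≡_; _≢_; refl; cong; subst) renaming (sym to ≡-sym; trans to ≡-trans)

private
  variable
    n k : ℕ

subset : {P : Fin k → Set} → Decidable P → Subset k
subset P? = tabulate (does ∘ P?)

module _ {P : Fin k → Set} (P? : Decidable P) where

  ∈-subset⁻ : ∀ {c} → c ∈ subset P? → P c
  ∈-subset⁻ {c} c∈ = invert (subst (Reflects (P c))
    (≡-trans (≡-sym (lookup∘tabulate (does ∘ P?) c)) ([]=⇒lookup c∈)) (proof (P? c)))

  ∈-subset⁺ : ∀ {c} → P c → c ∈ subset P?
  ∈-subset⁺ {c} p =
    lookup⇒[]= c (subset P?) (≡-trans (lookup∘tabulate (does ∘ P?) c) (dec-true (P? c) p))

∈⁅⁆-unique : ∀ {a b s : Fin k} → a ∈ ⁅ s ⁆ → b ∈ ⁅ s ⁆ → a ≡ b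
∈⁅⁆-unique {s = s} a∈ b∈ = ≡-trans (x∈⁅y⁆⇒x≡y s a∈) (≡-sym (x∈⁅y⁆⇒x≡y s b∈))

∈∁⁅⁆⇒≢ : ∀ {c d : Fin k} → d ∈ ∁ ⁅ c ⁆ → d ≢ c
∈∁⁅⁆⇒≢ = x∉⁅y⁆⇒x≢y ∘ x∈∁p⇒x∉p

≢⇒∈∁⁅⁆ : ∀ {c d : Fin k} → d ≢ c → d ∈ ∁ ⁅ c ⁆
≢⇒∈∁⁅⁆ = x∉p⇒x∈∁p ∘ x≢y⇒x∉⁅y⁆

other-than : 2 ≤ k → (c : Fin k) → ∃ λ d → d ≢ c
other-than (s≤s (s≤s _)) zero    = suc zero , λ ()
other-than (s≤s (s≤s _)) (suc _) = zero , λ ()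

two-others : 3 ≤ k → (c : Fin k) → ∃₂ λ d₁ d₂ → d₁ ≢ c × d₂ ≢ c × d₁ ≢ d₂
two-others (s≤s (s≤s (s≤s _))) zero          = suc zero , suc (suc zero) , (λ ()) , (λ ()) , (λ ())
two-others (s≤s (s≤s (s≤s _))) (suc zero)    = zero , suc (suc zero) , (λ ()) , (λ ()) , (λ ())
two-others (s≤s (s≤s (s≤s _))) (suc (suc _)) = zero , suc zero , (λ ()) , (λ ()) , (λ ())

Universal : (Fin k → Fin k → Set) → Fin k → Set
Universal R c = ∀ d → d ≢ c → R c d

Isolated : (Fin k → Fin k → Set) → Fin k → Set
Isolated R c = ∀ d → d ≢ c → ¬ R c d

prime⇒module-full : ∀ {R : Fin k → Fin k → Set} {S i j} → IsPrimeGraph R → IsModule R (_∈ S) →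
                    i ∈ S → j ∈ S → i ≢ j → ∀ c → c ∈ S
prime⇒module-full (_ , trivial) S-module i∈S j∈S i≢j c with trivial _ S-module
... | inj₁ S≡⊤         = subst (c ∈_) (≡-sym S≡⊤) ∈⊤
... | inj₂ (_ , S≡⁅s⁆) = ⊥-elim (i≢j (∈⁅⁆-unique (subst (_ ∈_) S≡⁅s⁆ i∈S) (subst (_ ∈_) S≡⁅s⁆ j∈S)))

-- Otherwise the other vertices would form a module with at least two elements.
prime⇒¬universal⊎isolated : ∀ {R : Fin k → Fin k → Set} → IsPrimeGraph R →
                            ∀ c → ¬ (Universal R c ⊎ Isolated R c)
prime⇒¬universal⊎isolated {R = R} R-prime@(3≤k , _) c universal⊎isolated
  with two-others 3≤k c
... | d₁ , d₂ , d₁≢c , d₂≢c , d₁≢d₂ =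
  x∈∁p⇒x∉p (prime⇒module-full R-prime others-module (≢⇒∈∁⁅⁆ d₁≢c) (≢⇒∈∁⁅⁆ d₂≢c) d₁≢d₂ c) (x∈⁅x⁆ c)
  where
  outsider : ∀ z → ¬ z ∈ ∁ ⁅ c ⁆ →
             (∀ y → y ∈ ∁ ⁅ c ⁆ → R z y) ⊎ (∀ y → y ∈ ∁ ⁅ c ⁆ → ¬ R z y)
  outsider z z∉ rewrite x∈⁅y⁆⇒x≡y c (x∉∁p⇒x∈p z∉) =
    Sum.map (λ univ y → univ y ∘ ∈∁⁅⁆⇒≢) (λ iso y → iso y ∘ ∈∁⁅⁆⇒≢) universal⊎isolated

  others-module : IsModule R (_∈ ∁ ⁅ c ⁆)
  others-module = (d₁ , ≢⇒∈∁⁅⁆ d₁≢c) , outsider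

∈L-sub⇒∈L : {t : Tree n} (p : Pos t) → ∀ {v} → L p v → v ∈L t
∈L-sub⇒∈L here        v∈ = v∈
∈L-sub⇒∈L (there i p) v∈ = there i (∈L-sub⇒∈L p v∈)

_∈L?_ : (v : Fin n) (t : Tree n) → Dec (v ∈L t)
v ∈L? leaf a with v ≟ a
... | yes refl = yes here
... | no v≢a   = no λ { here → v≢a refl }
v ∈L? node k f with any? (λ i → v ∈L? f i)
... | yes (i , v∈) = yes (there i v∈)
... | no v∉        = no λ { (there i v∈) → v∉ (i , v∈) }

UniqueLeaves : Tree n → Set
UniqueLeaves t = ∀ v (p q : v ∈L t) → p ≡ q

Disjoint : (Fin k → Tree n) → Set
Disjoint f = ∀ {i j v} → v ∈L f i → v ∈L f j → i ≡ j

there-injective : ∀ {f : Fin k → Tree n} {v i} {p q : v ∈L f i} →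
                  _≡_ {A = v ∈L node k f} (there i p) (there i q) → p ≡ q
there-injective refl = refl

uniqueLeaves-child : ∀ {f : Fin k → Tree n} → UniqueLeaves (node k f) → ∀ i → UniqueLeaves (f i)
uniqueLeaves-child unique i v p q = there-injective (unique v (there i p) (there i q))

uniqueLeaves⇒disjoint : ∀ {f : Fin k → Tree n} → UniqueLeaves (node k f) → Disjoint f
uniqueLeaves⇒disjoint unique {i} {j} {v} p q with unique v (there i p) (there j q)
... | refl = refl

lca-child : ∀ {f : Fin k → Tree n} {i} {p : Pos (f i)} {u v} →
            IsLCA {t = node k f} (there i p) u v → IsLCA p u v
lca-child {i = i} (u∈ , v∈ , lowest) = u∈ , v∈ , λ λ' ch → lowest (there i λ') (c-there i ch)

lca⇒distinct-children : ∀ {t : Tree n} {ω λ₁ λ₂ : Pos t} {u v} → IsLCA ω u v →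
                        ChildOf λ₁ ω → L λ₁ u → L λ₂ v → λ₁ ≢ λ₂
lca⇒distinct-children (_ , _ , lowest) ch u∈ v∈ refl = lowest _ ch (u∈ , v∈)

lca-antisym : ∀ {t : Tree n} → UniqueLeaves t → (p q : Pos t) → ∀ {u v w x} →
              IsLCA p u v → IsLCA q w x → L q u → L q v → L p w → L p x → p ≡ q
lca-antisym _ here here _ _ _ _ _ _ = refl
lca-antisym _ here (there i q) (_ , _ , lowest) _ u∈q v∈q _ _ =
  ⊥-elim (lowest (there i here) (c-here i) (∈L-sub⇒∈L q u∈q , ∈L-sub⇒∈L q v∈q))
lca-antisym _ (there i p) here _ (_ , _ , lowest) _ _ w∈p x∈p =
  ⊥-elim (lowest (there i here) (c-here i) (∈L-sub⇒∈L p w∈p , ∈L-sub⇒∈L p x∈p))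
lca-antisym {t = node k f} unique (there i p) (there j q) p-lca q-lca u∈q v∈q w∈p x∈p
  with uniqueLeaves⇒disjoint unique (∈L-sub⇒∈L p (proj₁ p-lca)) (∈L-sub⇒∈L q u∈q)
... | refl = cong (there i)
  (lca-antisym (uniqueLeaves-child unique i) p q (lca-child p-lca) (lca-child q-lca) u∈q v∈q w∈p x∈p)

module Decomposition (G : Graph n) where

  Joined : (Fin n → Set) → (Fin n → Set) → Set
  Joined A C = ∀ {a c} → A a → C c → E G a c

  joined-sym : ∀ {A C} → Joined A C → Joined C A
  joined-sym A⊗C c∈C a∈A = sym G (A⊗C a∈A c∈C)

  joined⇒disjoint : ∀ {A C} → Joined A C → ∀ {a} → A a → ¬ C a
  joined⇒disjoint A⊗C a∈A a∈C = irrefl G (A⊗C a∈A a∈C)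

  ChildModules : (Fin k → Tree n) → Set
  ChildModules f = ∀ c → IsModule (E G) (_∈L f c)

  AllModules : Tree n → Set
  AllModules t = ∀ (p : Pos t) → IsModule (E G) (L p)

  Meets : (Fin k → Tree n) → (Fin n → Set) → Fin k → Set
  Meets f A c = ∃ λ a → a ∈L f c × A a

  adjacent-to-one⇒adjacent-to-all : ∀ {M z y} → IsModule (E G) M → ¬ M z → M y → E G z y →
                                    ∀ {y'} → M y' → E G z y'
  adjacent-to-one⇒adjacent-to-all {z = z} (_ , outsider) z∉M y∈M zy with outsider z z∉M
  ... | inj₁ all  = all _
  ... | inj₂ none = ⊥-elim (none _ y∈M zy)

  quotient-edge⇒joined : ∀ {f : Fin k → Tree n} → Disjoint f → ChildModules f →
                         ∀ {c d} → QE G f c d → Joined (_∈L f c) (_∈L f d)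
  quotient-edge⇒joined disjoint modules {c} {d} (c≢d , a' , b' , a'∈c , b'∈d , a'b') a∈c b∈d =
    sym G (adjacent-to-one⇒adjacent-to-all (modules c) (λ b∈c → c≢d (disjoint b∈c b∈d))
             a'∈c (sym G a'b) a∈c)
    where
    a'b : E G a' _
    a'b = adjacent-to-one⇒adjacent-to-all (modules d) (c≢d ∘ disjoint a'∈c) b'∈d a'b' b∈d

  complete⇒children-joined : ∀ {t} → UniqueLeaves t → AllModules t → (ω : Pos t) →
                             IsCompleteNode G (sub ω) → ∀ {λ₁ λ₂} → ChildOf λ₁ ω → ChildOf λ₂ ω →
                             λ₁ ≢ λ₂ → Joined (L λ₁) (L λ₂)
  complete⇒children-joined unique modules here ω-complete (c-here i) (c-here j) λ₁≢λ₂ with i ≟ j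
  ... | yes refl = ⊥-elim (λ₁≢λ₂ refl)
  ... | no i≢j   = quotient-edge⇒joined (uniqueLeaves⇒disjoint unique)
                     (λ c → modules (there c here)) (ω-complete i j i≢j)
  complete⇒children-joined unique modules (there i ω) ω-complete (c-there i ch₁) (c-there i ch₂)
    λ₁≢λ₂ =
    complete⇒children-joined (uniqueLeaves-child unique i) (λ p → modules (there i p)) ω ω-complete
      ch₁ ch₂ (λ₁≢λ₂ ∘ cong (there i))

  -- The children meeting A form a module of the prime quotient, so A meets every
  -- child; a vertex outside A would then make its child universal or isolated.
  module-meeting-two-children-of-prime⇒covers :
    ∀ {f : Fin k → Tree n} → Disjoint f → ChildModules f → IsPrimeGraph (QE G f) →
    ∀ {A} → Decidable A → IsModule (E G) A → ∀ {i j} → i ≢ j → Meets f A i → Meets f A j →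
    ∀ {z} → z ∈L node k f → A z
  module-meeting-two-children-of-prime⇒covers {k = k} {f = f} disjoint modules f-prime {A} A?
    A-module {i} {j} i≢j meets-i meets-j = covers
    where
    meets? : Decidable (Meets f A)
    meets? c = any? λ a → (a ∈L? f c) ×-dec A? a

    outsider : ∀ c → ¬ c ∈ subset meets? →
               (∀ d → d ∈ subset meets? → QE G f c d) ⊎ (∀ d → d ∈ subset meets? → ¬ QE G f c d)
    outsider c c∉ with proj₁ (modules c)
    ... | z , z∈c with proj₂ A-module z (λ z∈A → c∉ (∈-subset⁺ meets? (z , z∈c , z∈A)))
    ... | inj₁ all  = inj₁ λ d d∈ → let a , a∈d , a∈A = ∈-subset⁻ meets? d∈ in
                        (λ { refl → c∉ d∈ }) , z , a , z∈c , a∈d , all a a∈A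
    ... | inj₂ none = inj₂ λ d d∈ cd → let a , a∈d , a∈A = ∈-subset⁻ meets? d∈ in
                        none a a∈A (quotient-edge⇒joined disjoint modules cd z∈c a∈d)

    meets-all : ∀ c → Meets f A c
    meets-all c = ∈-subset⁻ meets? (prime⇒module-full f-prime
      ((i , ∈-subset⁺ meets? meets-i) , outsider)
      (∈-subset⁺ meets? meets-i) (∈-subset⁺ meets? meets-j) i≢j c)

    covers : ∀ {z} → z ∈L node k f → A z
    covers {z} (there c z∈c) with A? z
    ... | yes z∈A = z∈A
    ... | no z∉A  = ⊥-elim (prime⇒¬universal⊎isolated f-prime c
                      (Sum.map universal isolated (proj₂ A-module z z∉A)))
      where
      universal : (∀ y → A y → E G z y) → Universal (QE G f) c
      universal all d d≢c = let a , a∈d , a∈A = meets-all d in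
        (d≢c ∘ ≡-sym) , z , a , z∈c , a∈d , all a a∈A

      isolated : (∀ y → A y → ¬ E G z y) → Isolated (QE G f) c
      isolated none d _ cd = let a , a∈d , a∈A = meets-all d in
        none a a∈A (quotient-edge⇒joined disjoint modules cd z∈c a∈d)

  -- IsCanonicalMD minus the covering condition, so that it passes to subtrees.
  record IsCanonicalSubtree (t : Tree n) : Set where
    field
      uniqueLeaves : UniqueLeaves t
      modules      : AllModules t
      branching    : ∀ (μ : Pos t) → AtLeastTwoChildren (sub μ)
      types        : ∀ (μ : Pos t) → IsInner (sub μ) →
                     IsEmptyNode G (sub μ) ⊎ IsCompleteNode G (sub μ) ⊎ IsPrimeNode G (sub μ)
      noCC         : ∀ (μ λ' : Pos t) → ChildOf λ' μ →
                     ¬ (IsCompleteNode G (sub μ) × IsCompleteNode G (sub λ'))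
  open IsCanonicalSubtree

  canonical⇒canonicalSubtree : ∀ {B} → IsCanonicalMD G B → IsCanonicalSubtree B
  canonical⇒canonicalSubtree canonical = record
    { uniqueLeaves = proj₂ ∘ leafSet
    ; modules      = B-modules
    ; branching    = IsCanonicalMD.branching canonical
    ; types        = IsCanonicalMD.types canonical
    ; noCC         = IsCanonicalMD.noCC canonical
    }
    where open IsModularDecomposition (IsCanonicalMD.isMD canonical) renaming (modules to B-modules)

  canonicalSubtree-child : ∀ {f : Fin k → Tree n} → IsCanonicalSubtree (node k f) →
                           ∀ i → IsCanonicalSubtree (f i)
  canonicalSubtree-child canonical i = record
    { uniqueLeaves = uniqueLeaves-child (uniqueLeaves canonical) i
    ; modules      = λ p → modules canonical (there i p)
    ; branching    = λ p → branching canonical (there i p)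
    ; types        = λ p → types canonical (there i p)
    ; noCC         = λ p q ch → noCC canonical (there i p) (there i q) (c-there i ch)
    }

  ¬complete⇒¬universal-child : ∀ {f : Fin k → Tree n} → IsCanonicalSubtree (node k f) →
                               ¬ IsCompleteNode G (node k f) → ∀ e → ¬ Universal (QE G f) e
  ¬complete⇒¬universal-child canonical ¬complete e universal with types canonical here tt
  ... | inj₁ empty-quotient =
    let e' , e'≢e = other-than (branching canonical here) e in empty-quotient e e' (universal e' e'≢e)
  ... | inj₂ (inj₁ complete-quotient) = ¬complete complete-quotient
  ... | inj₂ (inj₂ prime-quotient)    = prime⇒¬universal⊎isolated prime-quotient e (inj₁ universal)

  module _ {A C : Fin n → Set} (A? : Decidable A) (A-module : IsModule (E G) A)
           (A⊗C : Joined A C) where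

    ¬noncomplete-dominated-by-A :
      ∀ {s} → IsCanonicalSubtree s → ¬ IsCompleteNode G s → (μ : Pos s) → IsCompleteNode G (sub μ) →
      ∀ {u v y} → A u → C v → L μ u → L μ v → A y → (∀ {z} → z ∈L s → E G y z) → ⊥
    ¬noncomplete-dominated-by-A _ ¬complete here μ-complete _ _ _ _ _ _ = ¬complete μ-complete
    ¬noncomplete-dominated-by-A {node k g} canonical ¬complete (there e μ) _ {u} {v} {y}
      u∈A v∈C u∈μ v∈μ y∈A y-dominates =
      ¬complete⇒¬universal-child canonical ¬complete e universal
      where
      universal : Universal (QE G g) e
      universal e' e'≢e with proj₁ (modules canonical (there e' here))
      ... | y' , y'∈e' with A? y'
      ... | yes y'∈A = (e'≢e ∘ ≡-sym) , v , y' , ∈L-sub⇒∈L μ v∈μ , y'∈e' , joined-sym A⊗C v∈C y'∈A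
      ... | no y'∉A  = (e'≢e ∘ ≡-sym) , u , y' , ∈L-sub⇒∈L μ u∈μ , y'∈e' ,
        sym G (adjacent-to-one⇒adjacent-to-all A-module y'∉A y∈A
                 (sym G (y-dominates (there e' y'∈e'))) u∈A)

    ¬A-in-sibling-of-complete :
      ∀ {f : Fin k → Tree n} → IsCanonicalSubtree (node k f) → ∀ {i j} → i ≢ j →
      (μ : Pos (f i)) → IsCompleteNode G (sub μ) →
      ∀ {u v y} → A u → C v → L μ u → L μ v → A y → y ∈L f j → ⊥
    ¬A-in-sibling-of-complete {f = f} canonical {i} {j} i≢j μ μ-complete {u} {v} {y}
      u∈A v∈C u∈μ v∈μ y∈A y∈j with types canonical here tt
    ... | inj₁ empty-quotient =
      empty-quotient j i ((i≢j ∘ ≡-sym) , y , v , y∈j , ∈L-sub⇒∈L μ v∈μ , A⊗C y∈A v∈C)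
    ... | inj₂ (inj₂ prime-quotient) = joined⇒disjoint A⊗C
      (module-meeting-two-children-of-prime⇒covers disjoint (λ c → modules canonical (there c here))
        prime-quotient A? A-module i≢j (u , ∈L-sub⇒∈L μ u∈μ , u∈A) (y , y∈j , y∈A)
        (there i (∈L-sub⇒∈L μ v∈μ)))
      v∈C
      where
      disjoint : Disjoint f
      disjoint = uniqueLeaves⇒disjoint (uniqueLeaves canonical)
    ... | inj₂ (inj₁ complete-quotient) =
      ¬noncomplete-dominated-by-A (canonicalSubtree-child canonical i)
        (λ fi-complete → noCC canonical here (there i here) (c-here i)
                           (complete-quotient , fi-complete))
        μ μ-complete u∈A v∈C u∈μ v∈μ y∈A y-dominates
      where
      y-dominates : ∀ {z} → z ∈L f i → E G y z
      y-dominates = adjacent-to-one⇒adjacent-to-all (modules canonical (there i here))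
        (λ y∈i → i≢j (uniqueLeaves⇒disjoint (uniqueLeaves canonical) y∈i y∈j))
        (∈L-sub⇒∈L μ v∈μ) (A⊗C y∈A v∈C)

    complete-meeting-A-and-C⇒contains-A :
      ∀ {t} → IsCanonicalSubtree t → (μ : Pos t) → IsCompleteNode G (sub μ) →
      ∀ {u v} → A u → C v → L μ u → L μ v → ∀ {y} → A y → y ∈L t → L μ y
    complete-meeting-A-and-C⇒contains-A _ here _ _ _ _ _ _ y∈t = y∈t
    complete-meeting-A-and-C⇒contains-A canonical (there i μ) μ-complete u∈A v∈C u∈μ v∈μ y∈A
      (there j y∈j) with i ≟ j
    ... | yes refl = complete-meeting-A-and-C⇒contains-A (canonicalSubtree-child canonical i) μ
                       μ-complete u∈A v∈C u∈μ v∈μ y∈A y∈j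
    ... | no i≢j   = ⊥-elim (¬A-in-sibling-of-complete canonical i≢j μ μ-complete
                       u∈A v∈C u∈μ v∈μ y∈A y∈j)

  complete-meeting-joined-modules⇒contains-both :
    ∀ {t A C} → IsCanonicalSubtree t → Decidable A → Decidable C →
    IsModule (E G) A → IsModule (E G) C → Joined A C →
    (μ : Pos t) → IsCompleteNode G (sub μ) → ∀ {a c} → A a → C c → L μ a → L μ c →
    ∀ {y} → y ∈L t → A y ⊎ C y → L μ y
  complete-meeting-joined-modules⇒contains-both canonical A? C? A-module C-module A⊗C μ μ-complete
    a∈A c∈C a∈μ c∈μ y∈t (inj₁ y∈A) =
    complete-meeting-A-and-C⇒contains-A A? A-module A⊗C canonical μ μ-complete
      a∈A c∈C a∈μ c∈μ y∈A y∈t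
  complete-meeting-joined-modules⇒contains-both canonical A? C? A-module C-module A⊗C μ μ-complete
    a∈A c∈C a∈μ c∈μ y∈t (inj₂ y∈C) =
    complete-meeting-A-and-C⇒contains-A C? C-module (joined-sym A⊗C) canonical μ μ-complete
      c∈C a∈A c∈μ a∈μ y∈C y∈t

open Decomposition

mainTheorem12 : ∀ {n} (G : Graph n) → IsComparability G →
    (B : Tree n) → IsCanonicalMD G B →
    (T : Tree n) (R : RestrictedMD G T) →
    ∀ (u v w x : Fin n) → E G u v → E G w x →
    (μ ν : Pos B) → IsLCA μ u v → IsLCA ν w x →
    IsCompleteNode G (sub μ) → IsCompleteNode G (sub ν) →
    (ω : Pos T) → IsInner (sub ω) → label R ω ≡ complete →
    IsLCA ω u v → IsLCA ω w x →
    (λ₁ λ₂ : Pos T) → ChildOf λ₁ ω → ChildOf λ₂ ω →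
    L λ₁ u → L λ₂ v → (L λ₁ w × L λ₂ x) ⊎ (L λ₂ w × L λ₁ x) →
    μ ≡ ν
mainTheorem12 G _ B B-canonical T R u v w x _ _ μ ν μ-lca ν-lca μ-complete ν-complete
  ω ω-inner ω-labelled ω-lca _ λ₁ λ₂ ch₁ ch₂ u∈λ₁ v∈λ₂ w,x∈ =
  lca-antisym (proj₂ ∘ leafSetB) μ ν μ-lca ν-lca
    (ν-contains (inj₁ u∈λ₁)) (ν-contains (inj₂ v∈λ₂))
    (μ-contains (Sum.map proj₁ proj₁ w,x∈)) (μ-contains (Sum.swap (Sum.map proj₂ proj₂ w,x∈)))
  where
  open IsModularDecomposition (isMD R)
  open IsModularDecomposition (IsCanonicalMD.isMD B-canonical) using () renaming (leafSet to leafSetB)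

  λ₁⊗λ₂ : Joined G (L λ₁) (L λ₂)
  λ₁⊗λ₂ = complete⇒children-joined G (proj₂ ∘ leafSet) modules ω
    (labelComplete R ω ω-inner ω-labelled) ch₁ ch₂ (lca⇒distinct-children ω-lca ch₁ u∈λ₁ v∈λ₂)

  contains : (ρ : Pos B) → IsCompleteNode G (sub ρ) → ∀ {a c} → L ρ a → L ρ c →
             (L λ₁ a × L λ₂ c) ⊎ (L λ₂ a × L λ₁ c) → ∀ {y} → L λ₁ y ⊎ L λ₂ y → L ρ y
  contains ρ ρ-complete a∈ρ c∈ρ (inj₁ (a∈λ₁ , c∈λ₂)) {y} =
    complete-meeting-joined-modules⇒contains-both G (canonical⇒canonicalSubtree G B-canonical)
      (_∈L? sub λ₁) (_∈L? sub λ₂) (modules λ₁) (modules λ₂) λ₁⊗λ₂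
      ρ ρ-complete a∈λ₁ c∈λ₂ a∈ρ c∈ρ (proj₁ (leafSetB y))
  contains ρ ρ-complete a∈ρ c∈ρ (inj₂ (a∈λ₂ , c∈λ₁)) =
    contains ρ ρ-complete c∈ρ a∈ρ (inj₁ (c∈λ₁ , a∈λ₂))

  μ-contains : ∀ {y} → L λ₁ y ⊎ L λ₂ y → L μ y
  μ-contains = contains μ μ-complete (proj₁ μ-lca) (proj₁ (proj₂ μ-lca)) (inj₁ (u∈λ₁ , v∈λ₂))

  ν-contains : ∀ {y} → L λ₁ y ⊎ L λ₂ y → L ν y
  ν-contains = contains ν ν-complete (proj₁ ν-lca) (proj₁ (proj₂ ν-lca)) w,x∈
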